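{- For every derivation $\Delta$ of the sequent system $\mathsf{Gentzen}$ with premisses $\phi_1,\dots,\phi_h$ and conclusion $\psi$ there is a derivation $\Phi$ in the CoS system $\mathsf{SKSg}$ with premiss $(\phi_1\wedge\dots\wedge\phi_h)$ and conclusion $\psi$ (sequents read as disjunctions); if $n$ is the size of $\Delta$, the size of $\Phi$ is $O(n^2)$; moreover, if $\Delta$ is analytic then $\Phi$ is a derivation in $\mathsf{KSg}$.
   Context: CoS: formulae are built from units $\mathsf f,\mathsf t$, atoms $a,\bar a,\dots$, formula variables $A,\bar A,\dots$ by $[\alpha\vee\beta]$ and $(\alpha\wedge\beta)$; $\bar\cdot$ is an involution on atoms and on variables ($\bar a\ne a$); the De Morgan dual $\bar\alpha$ exchanges $\vee/\wedge$, $\mathsf t/\mathsf f$ and negates atoms and variables. Equality $=$ is the smallest context-closed equivalence containing commutativity and associativity of $\vee,\wedge$, $[\alpha\vee\mathsf f]=\alpha$, $(\alpha\wedge\mathsf t)=\alpha$, $[\mathsf t\vee\mathsf t]=\mathsf t$, $(\mathsf f\wedge\mathsf f)=\mathsf f$. A rule $\alpha/\beta$ has instances $\alpha\rho\sigma/\beta\rho\sigma$ for a renaming $\rho$ (atoms to atoms) and a substitution $\sigma$ (variables to formulae, $\bar A\mapsto$ dual); it generates steps $\xi\{\gamma\}/\xi\{\delta\}$ for any context (formula with one hole) $\xi$. A derivation in $\mathcal S$ with premiss $\alpha_0$ and conclusion $\alpha_k$ is a chain $\alpha_0,\dots,\alpha_k$ alternating $=$-steps and steps generated by rules of $\mathcal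 S$; size = number of occurrences of units, atoms and variables in it. $\mathsf{KSg}$ has rules $\mathsf t/[A\vee\bar A]$, $\mathsf f/A$, $[A\vee A]/A$, $(A\wedge[B\vee C])/[(A\wedge B)\vee C]$; $\mathsf{SKSg}$ additionally has $(A\wedge\bar A)/\mathsf f$, $A/\mathsf t$, $A/(A\wedge A)$. $\mathsf{Gentzen}$: one-sided sequents $\phi$ are multisets of CoS formulae (comma = multiset union), and a sequent $\alpha_1,\dots,\alpha_h$ is read as the formula $[\alpha_1\vee\dots\vee\alpha_h]$. Rules (with $A,B$ standing for arbitrary formulae and $\phi,\psi$ for multisets): identity $\vdash A,\bar A$; true $\vdash\mathsf t$; weakening from $\phi$ infer $\phi,A$; contraction from $\phi,A,A$ infer $\phi,A$; disjunction from $\phi,A,B$ infer $\phi,A\vee B$; conjunction from $\phi,A$ and $B,\psi$ infer $\phi,A\wedge B,\psi$; cut from $\phi,A$ and $\bar A,\psi$ infer $\phi,\psi$. Derivations are trees of rule instances; their unproved leaves are premisses and the root is the conclusion; size = number of occurrences of units, atoms and variables. A derivation is analytic if it contains no cut. An empty conjunction is represented by a conjunction of units $\mathsf t$. -}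

module Defs where

open import Data.Nat using (ℕ; zero; suc; _+_; _*_; _≤_)
open import Data.Bool using (Bool; true; false)
open import Data.List using (List; []; _∷_; _++_; map)
open import Data.List.Membership.Propositional using (_∈_)
open import Data.List.Relation.Binary.Permutation.Propositional using (_↭_)
open import Data.Unit using (⊤)
open import Data.Empty using (⊥)
open import Data.Product using (_×_)

-- Literals: used both for atoms and for formula variables.
-- pos n is the name n, neg n is its bar; bar is a fixpoint-free involution.

data Lit : Set where
  pos : ℕ → Lit
  neg : ℕ → Lit

bar : Lit → Lit
bar (pos n) = neg n
bar (neg n) = pos n

infixr 6 _∨_
infixr 7 _∧_

data Fm : Set where
  𝕗 : Fm
  𝕥 : Fm
  atom : Lit → Fm
  var : Lit → Fm
  _∨_ : Fm → Fm → Fm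
  _∧_ : Fm → Fm → Fm

dual : Fm → Fm
dual 𝕗 = 𝕥
dual 𝕥 = 𝕗
dual (atom l) = atom (bar l)
dual (var l) = var (bar l)
dual (α ∨ β) = dual α ∧ dual β
dual (α ∧ β) = dual α ∨ dual β

fsize : Fm → ℕ
fsize 𝕗 = 1
fsize 𝕥 = 1
fsize (atom _) = 1
fsize (var _) = 1
fsize (α ∨ β) = fsize α + fsize β
fsize (α ∧ β) = fsize α + fsize β

infix 4 _≈_

data _≈_ : Fm → Fm → Set where
  ≈-refl  : ∀ {α} → α ≈ α
  ≈-sym   : ∀ {α β} → α ≈ β → β ≈ α
  ≈-trans : ∀ {α β γ} → α ≈ β → β ≈ γ → α ≈ γ
  ∨-cong  : ∀ {α α' β β'} → α ≈ α' → β ≈ β' → (α ∨ β) ≈ (α' ∨ β')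
  ∧-cong  : ∀ {α α' β β'} → α ≈ α' → β ≈ β' → (α ∧ β) ≈ (α' ∧ β')
  ∨-comm  : ∀ {α β} → (α ∨ β) ≈ (β ∨ α)
  ∧-comm  : ∀ {α β} → (α ∧ β) ≈ (β ∧ α)
  ∨-assoc : ∀ {α β γ} → ((α ∨ β) ∨ γ) ≈ (α ∨ (β ∨ γ))
  ∧-assoc : ∀ {α β γ} → ((α ∧ β) ∧ γ) ≈ (α ∧ (β ∧ γ))
  ∨-unit  : ∀ {α} → (α ∨ 𝕗) ≈ α
  ∧-unit  : ∀ {α} → (α ∧ 𝕥) ≈ α
  𝕥∨𝕥     : (𝕥 ∨ 𝕥) ≈ 𝕥
  𝕗∧𝕗     : (𝕗 ∧ 𝕗) ≈ 𝕗

data Ctx : Set where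
  □   : Ctx
  _∨ˡ_ : Ctx → Fm → Ctx
  _∨ʳ_ : Fm → Ctx → Ctx
  _∧ˡ_ : Ctx → Fm → Ctx
  _∧ʳ_ : Fm → Ctx → Ctx

plug : Ctx → Fm → Fm
plug □ γ = γ
plug (ξ ∨ˡ β) γ = plug ξ γ ∨ β
plug (α ∨ʳ ξ) γ = α ∨ plug ξ γ
plug (ξ ∧ˡ β) γ = plug ξ γ ∧ β
plug (α ∧ʳ ξ) γ = α ∧ plug ξ γ

record Rule : Set where
  constructor _/_
  field
    prem  : Fm
    concl : Fm
open Rule public

Renaming : Set
Renaming = ℕ → Lit

rename : Renaming → Fm → Fm
rename ρ 𝕗 = 𝕗
rename ρ 𝕥 = 𝕥
rename ρ (atom (pos n)) = atom (ρ n)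
rename ρ (atom (neg n)) = atom (bar (ρ n))
rename ρ (var l) = var l
rename ρ (α ∨ β) = rename ρ α ∨ rename ρ β
rename ρ (α ∧ β) = rename ρ α ∧ rename ρ β

Substitution : Set
Substitution = ℕ → Fm

subst : Substitution → Fm → Fm
subst σ 𝕗 = 𝕗
subst σ 𝕥 = 𝕥
subst σ (atom l) = atom l
subst σ (var (pos n)) = σ n
subst σ (var (neg n)) = dual (σ n)
subst σ (α ∨ β) = subst σ α ∨ subst σ β
subst σ (α ∧ β) = subst σ α ∧ subst σ β

inst : Renaming → Substitution → Fm → Fm
inst ρ σ α = subst σ (rename ρ α)

data Step (S : List Rule) : Fm → Fm → Set where
  step : (r : Rule) → r ∈ S → (ρ : Renaming) (σ : Substitution) (ξ : Ctx) →
         Step S (plug ξ (inst ρ σ (prem r))) (plug ξ (inst ρ σ (concl r)))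

stepRule : ∀ {S α β} → Step S α β → Rule
stepRule (step r _ _ _ _) = r

-- CoS derivation: chain α₀ = α₁ ρ α₂ = α₃ ... alternating =-steps and rule steps
-- (starting and ending with an =-step, possibly trivial).
data Deriv (S : List Rule) : Fm → Fm → Set where
  done : ∀ {α β} → α ≈ β → Deriv S α β
  more : ∀ {α β γ δ} → α ≈ β → Step S β γ → Deriv S γ δ → Deriv S α δ

dsize : ∀ {S α β} → Deriv S α β → ℕ
dsize {α = α} {β} (done _) = fsize α + fsize β
dsize {α = α} (more {β = β} _ _ d) = fsize α + fsize β + dsize d

RulesIn : ∀ {S α β} → List Rule → Deriv S α β → Set
RulesIn S' (done _) = ⊤
RulesIn S' (more _ s d) = (stepRule s ∈ S') × RulesIn S' d

vA vB vC : Fm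
vA = var (pos 0)
vB = var (pos 1)
vC = var (pos 2)

vĀ : Fm
vĀ = var (neg 0)

KSg : List Rule
KSg = (𝕥 / (vA ∨ vĀ))
    ∷ (𝕗 / vA)
    ∷ ((vA ∨ vA) / vA)
    ∷ ((vA ∧ (vB ∨ vC)) / ((vA ∧ vB) ∨ vC))
    ∷ []

SKSg : List Rule
SKSg = KSg ++ ((vA ∧ vĀ) / 𝕗) ∷ (vA / 𝕥) ∷ (vA / (vA ∧ vA)) ∷ []

-- Gentzen: one-sided sequents (lists up to permutation = multisets)

Seq : Set
Seq = List Fm

ssize : Seq → ℕ
ssize [] = 0
ssize (α ∷ φ) = fsize α + ssize φ

disj : Seq → Fm
disj [] = 𝕗
disj (α ∷ []) = α
disj (α ∷ φ@(_ ∷ _)) = α ∨ disj φ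

conj : List Fm → Fm
conj [] = 𝕥
conj (α ∷ []) = α
conj (α ∷ φ@(_ ∷ _)) = α ∧ conj φ

-- GD P φ : Gentzen derivation with premisses P (unproved leaves) and conclusion φ.
-- 'exch' only expresses that sequents are multisets; it is not a rule instance.
data GD : List Seq → Seq → Set where
  leaf : (φ : Seq) → GD (φ ∷ []) φ
  ax   : (A : Fm) → GD [] (A ∷ dual A ∷ [])
  tru  : GD [] (𝕥 ∷ [])
  wk   : ∀ {P φ} (A : Fm) → GD P φ → GD P (φ ++ A ∷ [])
  ctr  : ∀ {P φ} (A : Fm) → GD P (φ ++ A ∷ A ∷ []) → GD P (φ ++ A ∷ [])
  dis  : ∀ {P φ} (A B : Fm) → GD P (φ ++ A ∷ B ∷ []) → GD P (φ ++ (A ∨ B) ∷ [])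
  con  : ∀ {P Q φ ψ} (A B : Fm) → GD P (φ ++ A ∷ []) → GD Q (B ∷ ψ) →
         GD (P ++ Q) (φ ++ (A ∧ B) ∷ ψ)
  cut  : ∀ {P Q φ ψ} (A : Fm) → GD P (φ ++ A ∷ []) → GD Q (dual A ∷ ψ) →
         GD (P ++ Q) (φ ++ ψ)
  exch : ∀ {P φ ψ} → φ ↭ ψ → GD P φ → GD P ψ

gsize : ∀ {P φ} → GD P φ → ℕ
gsize (leaf φ) = ssize φ
gsize (ax A) = ssize (A ∷ dual A ∷ [])
gsize tru = 1
gsize {φ = φ} (wk A d) = ssize φ + gsize d
gsize {φ = φ} (ctr A d) = ssize φ + gsize d
gsize {φ = φ} (dis A B d) = ssize φ + gsize d
gsize {φ = φ} (con A B d e) = ssize φ + gsize d + gsize e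
gsize {φ = φ} (cut A d e) = ssize φ + gsize d + gsize e
gsize (exch _ d) = gsize d

Analytic : ∀ {P φ} → GD P φ → Set
Analytic (leaf _) = ⊤
Analytic (ax _) = ⊤
Analytic tru = ⊤
Analytic (wk _ d) = Analytic d
Analytic (ctr _ d) = Analytic d
Analytic (dis _ _ d) = Analytic d
Analytic (con _ _ d e) = Analytic d × Analytic e
Analytic (cut _ _ _) = ⊥
Analytic (exch _ d) = Analytic d

module Submission where

-- Weakening and contraction become one
-- KSg step in a context, disjunction and exchange are equalities, and a binary
-- rule runs the two translated subderivations side by side inside a conjunction
-- and merges them by two switches (plus (A ∧ Ā)/f for cut, the only non-KSg rule).
-- The size bound comes from two linear invariants proved by induction on Δ, with
-- n = gsize Δ and s = ssize ψ (the credits in s are spent by the binary rules):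
--   translate-steps:  #steps + 2s ≤ 4n;
--   translate-every:  every formula F of the chain has  fsize F + s ≤ 2n + 1;
-- since a chain of k steps with formulae of size ≤ M has size ≤ (k + 1)·2M
-- (dsize-bound), the size is O(n²).

open import Defs
open import Data.Nat using (ℕ; zero; suc; _+_; _*_; _≤_; z≤n)
open import Data.Nat.Properties
open import Data.Nat.Tactic.RingSolver using (solve-∀)
open import Data.Nat.ListAction using (sum)
open import Data.Nat.ListAction.Properties using (sum-++; sum-↭)
open import Data.List using (List; []; _∷_; _++_; map)
open import Data.List.Properties using (map-++)
open import Data.List.Membership.Propositional using (_∈_)
open import Data.List.Membership.Propositional.Properties using (∈-++⁺ˡ)
open import Data.List.Relation.Unary.Any using (here; there)
import Data.List.Relation.Binary.Permutation.Propositional as Perm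
open import Data.List.Relation.Binary.Permutation.Propositional.Properties using (map⁺)
open import Data.Product using (Σ; _×_; _,_)
open import Data.Unit using (tt)
open import Relation.Binary.Bundles using (Setoid)
import Relation.Binary.Reasoning.Setoid as SetoidReasoning
open import Relation.Binary.PropositionalEquality as Eq using (_≡_; refl; cong; sym; subst₂)

private
  variable
    α β γ δ : Fm

-- A node with conclusion of size s and subderivations of total size g has budget
-- 2(s + g) + 1 for  fsize F + s ; these three lemmas say what fits into it
-- (for no, one and two subderivations).
fits₀ : ∀ {x} s → x ≤ s + 1 → x + s ≤ 2 * s + 1
fits₀ {x} s h = ≤-trans (+-monoˡ-≤ s h) (≤-reflexive (shape x s))
  where shape : ∀ x s → s + 1 + s ≡ 2 * s + 1
        shape = solve-∀

fits₁ : ∀ {x} s g → x ≤ s + 2 * g + 1 → x + s ≤ 2 * (s + g) + 1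
fits₁ s g h = ≤-trans (+-monoˡ-≤ s h) (≤-reflexive (shape s g))
  where shape : ∀ s g → s + 2 * g + 1 + s ≡ 2 * (s + g) + 1
        shape = solve-∀

fits₂ : ∀ {x} s g₁ g₂ → x ≤ s + (2 * g₁ + 2 * g₂) + 1 → x + s ≤ 2 * (s + g₁ + g₂) + 1
fits₂ s g₁ g₂ h = ≤-trans (+-monoˡ-≤ s h) (≤-reflexive (shape s g₁ g₂))
  where shape : ∀ s g₁ g₂ → s + (2 * g₁ + 2 * g₂) + 1 + s ≡ 2 * (s + g₁ + g₂) + 1
        shape = solve-∀

-- a nonempty conclusion pays one unit of the budget of its own derivation
drop-credit : ∀ {x s} g → 1 ≤ s → x + s ≤ 2 * g + 1 → x ≤ 2 * g
drop-credit {x} g 1≤s h =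
  +-cancelʳ-≤ 1 x (2 * g) (≤-trans (+-monoʳ-≤ x 1≤s) h)

side≤ : ∀ {s g} → 1 ≤ s → s ≤ g → s + 1 ≤ 2 * g
side≤ {s} {g} 1≤s s≤g = ≤-trans (+-mono-≤ s≤g (≤-trans 1≤s s≤g)) (≤-reflexive (shape g))
  where shape : ∀ g → g + g ≡ 2 * g
        shape = solve-∀

-- step credits: a unary rule spends at most one step, a binary one at most three
unary-credit : ∀ {t s g} → t ≤ 4 * g → 1 ≤ s → t + 1 + 2 * s ≤ 4 * (s + g)
unary-credit {t} {s} {g} h 1≤s = begin
  t + 1 + 2 * s        ≤⟨ +-monoˡ-≤ (2 * s) (+-monoʳ-≤ t 1≤s) ⟩
  t + s + 2 * s        ≤⟨ +-monoˡ-≤ (2 * s) (+-monoˡ-≤ s h) ⟩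
  4 * g + s + 2 * s    ≡⟨ shape g s ⟩
  3 * s + 4 * g        ≤⟨ +-monoˡ-≤ (4 * g) (*-monoˡ-≤ s (n≤1+n 3)) ⟩
  4 * s + 4 * g        ≡⟨ sym (*-distribˡ-+ 4 s g) ⟩
  4 * (s + g)          ∎
  where
  open ≤-Reasoning
  shape : ∀ g s → 4 * g + s + 2 * s ≡ 3 * s + 4 * g
  shape = solve-∀

binary-credit : ∀ {k s₁ s₂} t₁ t₂ s g₁ g₂ → t₁ + 2 * s₁ ≤ 4 * g₁ → t₂ + 2 * s₂ ≤ 4 * g₂ →
                1 ≤ s₁ → 1 ≤ s₂ → k ≤ 3 → t₁ + t₂ + k + 2 * s ≤ 4 * (s + g₁ + g₂)
binary-credit {k} {s₁} {s₂} t₁ t₂ s g₁ g₂ h₁ h₂ 1≤s₁ 1≤s₂ k≤3 = begin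
  t₁ + t₂ + k + 2 * s                         ≤⟨ +-monoˡ-≤ (2 * s) (+-monoʳ-≤ (t₁ + t₂) k≤credit) ⟩
  t₁ + t₂ + (2 * s₁ + 2 * s₂) + 2 * s         ≡⟨ regroup t₁ t₂ s₁ s₂ s ⟩
  (t₁ + 2 * s₁) + (t₂ + 2 * s₂) + 2 * s       ≤⟨ +-monoˡ-≤ (2 * s) (+-mono-≤ h₁ h₂) ⟩
  4 * g₁ + 4 * g₂ + 2 * s                     ≤⟨ +-monoʳ-≤ (4 * g₁ + 4 * g₂) (*-monoˡ-≤ s (m≤m+n 2 2)) ⟩
  4 * g₁ + 4 * g₂ + 4 * s                     ≡⟨ shape g₁ g₂ s ⟩
  4 * (s + g₁ + g₂)                           ∎
  where
  open ≤-Reasoning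
  k≤credit : k ≤ 2 * s₁ + 2 * s₂
  k≤credit = ≤-trans k≤3 (≤-trans (n≤1+n 3) (+-mono-≤ (*-monoʳ-≤ 2 1≤s₁) (*-monoʳ-≤ 2 1≤s₂)))
  regroup : ∀ t₁ t₂ s₁ s₂ s → t₁ + t₂ + (2 * s₁ + 2 * s₂) + 2 * s ≡ (t₁ + 2 * s₁) + (t₂ + 2 * s₂) + 2 * s
  regroup = solve-∀
  shape : ∀ g₁ g₂ s → 4 * g₁ + 4 * g₂ + 4 * s ≡ 4 * (s + g₁ + g₂)
  shape = solve-∀

-- the final quadratic estimate: (4n + 1) steps' worth of pairs of formulae of size ≤ 2n + 1
quadratic : ∀ n → (4 * n + 1) * ((2 * n + 1) + (2 * n + 1)) ≤ 28 * (n * n) + 28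
quadratic n = begin
  (4 * n + 1) * ((2 * n + 1) + (2 * n + 1)) ≡⟨ expand n ⟩
  16 * (n * n) + 12 * n + 2                 ≤⟨ +-monoˡ-≤ 2 (+-monoʳ-≤ (16 * (n * n)) (*-monoʳ-≤ 12 (n≤n*n+1 n))) ⟩
  16 * (n * n) + 12 * (n * n + 1) + 2       ≡⟨ collect n ⟩
  28 * (n * n) + 14                         ≤⟨ +-monoʳ-≤ (28 * (n * n)) (m≤m+n 14 14) ⟩
  28 * (n * n) + 28                         ∎
  where
  open ≤-Reasoning
  n≤n*n+1 : ∀ n → n ≤ n * n + 1
  n≤n*n+1 zero    = z≤n
  n≤n*n+1 (suc n) = ≤-trans (m≤m*n (suc n) (suc n)) (m≤m+n _ 1)
  expand : ∀ n → (4 * n + 1) * ((2 * n + 1) + (2 * n + 1)) ≡ 16 * (n * n) + 12 * n + 2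
  expand = solve-∀
  collect : ∀ n → 16 * (n * n) + 12 * (n * n + 1) + 2 ≡ 28 * (n * n) + 14
  collect = solve-∀

fsize-pos : ∀ A → 1 ≤ fsize A
fsize-pos 𝕗       = ≤-refl
fsize-pos 𝕥       = ≤-refl
fsize-pos (atom _) = ≤-refl
fsize-pos (var _)  = ≤-refl
fsize-pos (A ∨ B) = ≤-trans (fsize-pos A) (m≤m+n (fsize A) (fsize B))
fsize-pos (A ∧ B) = ≤-trans (fsize-pos A) (m≤m+n (fsize A) (fsize B))

ssize≡sum : ∀ φ → ssize φ ≡ sum (map fsize φ)
ssize≡sum []      = refl
ssize≡sum (α ∷ φ) = cong (fsize α +_) (ssize≡sum φ)

ssize-++ : ∀ φ ψ → ssize (φ ++ ψ) ≡ ssize φ + ssize ψ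
ssize-++ φ ψ = begin
  ssize (φ ++ ψ)                         ≡⟨ ssize≡sum (φ ++ ψ) ⟩
  sum (map fsize (φ ++ ψ))               ≡⟨ cong sum (map-++ fsize φ ψ) ⟩
  sum (map fsize φ ++ map fsize ψ)       ≡⟨ sum-++ (map fsize φ) (map fsize ψ) ⟩
  sum (map fsize φ) + sum (map fsize ψ)  ≡⟨ sym (Eq.cong₂ _+_ (ssize≡sum φ) (ssize≡sum ψ)) ⟩
  ssize φ + ssize ψ                      ∎
  where open Eq.≡-Reasoning

ssize-↭ : ∀ {φ ψ} → φ Perm.↭ ψ → ssize φ ≡ ssize ψ
ssize-↭ {φ} {ψ} p = Eq.trans (ssize≡sum φ) (Eq.trans (sum-↭ (map⁺ fsize p)) (sym (ssize≡sum ψ)))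

nonempty-size : ∀ φ A ψ → 1 ≤ ssize (φ ++ A ∷ ψ)
nonempty-size φ A ψ rewrite ssize-++ φ (A ∷ ψ) =
  ≤-trans (fsize-pos A) (≤-trans (m≤m+n (fsize A) (ssize ψ)) (m≤n+m _ (ssize φ)))

disj-size-∷ : ∀ α φ → fsize (disj (α ∷ φ)) ≡ ssize (α ∷ φ)
disj-size-∷ α []      = sym (+-identityʳ (fsize α))
disj-size-∷ α (β ∷ φ) = cong (fsize α +_) (disj-size-∷ β φ)

-- reading a sequent as a formula adds at most the unit f of the empty sequent
disj-size : ∀ φ → fsize (disj φ) ≤ ssize φ + 1
disj-size []      = ≤-refl
disj-size (α ∷ φ) = ≤-trans (≤-reflexive (disj-size-∷ α φ)) (m≤m+n (ssize (α ∷ φ)) 1)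

split-size : ∀ φ α χ → fsize (disj φ ∨ disj (α ∷ χ)) ≤ ssize (φ ++ α ∷ χ) + 1
split-size φ α χ = begin
  fsize (disj φ) + fsize (disj (α ∷ χ))  ≤⟨ +-mono-≤ (disj-size φ) (≤-reflexive (disj-size-∷ α χ)) ⟩
  ssize φ + 1 + ssize (α ∷ χ)            ≡⟨ Eq.trans (+-assoc (ssize φ) 1 _) (cong (ssize φ +_) (+-comm 1 _)) ⟩
  ssize φ + (ssize (α ∷ χ) + 1)          ≡⟨ sym (+-assoc (ssize φ) _ 1) ⟩
  ssize φ + ssize (α ∷ χ) + 1            ≡⟨ cong (_+ 1) (sym (ssize-++ φ (α ∷ χ))) ⟩
  ssize (φ ++ α ∷ χ) + 1                 ∎
  where open ≤-Reasoning

conj-size : ∀ xs ys → fsize (conj (xs ++ ys)) ≤ fsize (conj xs) + fsize (conj ys)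
conj-size []                ys       = m≤n+m _ 1
conj-size (x ∷ [])          []       = m≤m+n (fsize x) 1
conj-size (x ∷ [])          (_ ∷ _)  = ≤-refl
conj-size (x ∷ xs@(_ ∷ _))  ys       =
  ≤-trans (+-monoʳ-≤ (fsize x) (conj-size xs ys)) (≤-reflexive (sym (+-assoc (fsize x) _ _)))

premisses-size : ∀ P Q → fsize (conj (map disj (P ++ Q))) ≤ fsize (conj (map disj P)) + fsize (conj (map disj Q))
premisses-size P Q rewrite map-++ disj P Q = conj-size (map disj P) (map disj Q)

≈-setoid : Setoid _ _
≈-setoid = record
  { Carrier       = Fm
  ; _≈_           = _≈_
  ; isEquivalence = record { refl = ≈-refl ; sym = ≈-sym ; trans = ≈-trans }
  }

module ≈-Reasoning = SetoidReasoning ≈-setoid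

infixr 4 _⟫_
_⟫_ : α ≈ β → β ≈ γ → α ≈ γ
_⟫_ = ≈-trans

disj-cons : ∀ α φ → disj (α ∷ φ) ≈ α ∨ disj φ
disj-cons α []      = ≈-sym ∨-unit
disj-cons α (_ ∷ _) = ≈-refl

disj-++ : ∀ φ ψ → disj (φ ++ ψ) ≈ disj φ ∨ disj ψ
disj-++ []      ψ = ≈-sym (∨-comm ⟫ ∨-unit)
disj-++ (α ∷ φ) ψ = begin
  disj (α ∷ φ ++ ψ)          ≈⟨ disj-cons α (φ ++ ψ) ⟩
  α ∨ disj (φ ++ ψ)          ≈⟨ ∨-cong ≈-refl (disj-++ φ ψ) ⟩
  α ∨ (disj φ ∨ disj ψ)      ≈⟨ ≈-sym ∨-assoc ⟩
  (α ∨ disj φ) ∨ disj ψ      ≈⟨ ∨-cong (≈-sym (disj-cons α φ)) ≈-refl ⟩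
  disj (α ∷ φ) ∨ disj ψ      ∎
  where open ≈-Reasoning

disj-↭ : ∀ {φ ψ} → φ Perm.↭ ψ → disj φ ≈ disj ψ
disj-↭ Perm.refl = ≈-refl
disj-↭ {_ ∷ φ} {_ ∷ ψ} (Perm.prep α p) =
  disj-cons α φ ⟫ ∨-cong ≈-refl (disj-↭ p) ⟫ ≈-sym (disj-cons α ψ)
disj-↭ {_ ∷ _ ∷ φ} {_ ∷ _ ∷ ψ} (Perm.swap α β p) = begin
  disj (α ∷ β ∷ φ)      ≈⟨ disj-cons α (β ∷ φ) ⟫ ∨-cong ≈-refl (disj-cons β φ) ⟩
  α ∨ (β ∨ disj φ)      ≈⟨ ≈-sym ∨-assoc ⟩
  (α ∨ β) ∨ disj φ      ≈⟨ ∨-cong ∨-comm (disj-↭ p) ⟩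
  (β ∨ α) ∨ disj ψ      ≈⟨ ∨-assoc ⟩
  β ∨ (α ∨ disj ψ)      ≈⟨ ∨-cong ≈-refl (≈-sym (disj-cons α ψ)) ⟫ ≈-sym (disj-cons β (α ∷ ψ)) ⟩
  disj (β ∷ α ∷ ψ)      ∎
  where open ≈-Reasoning
disj-↭ (Perm.trans p q) = disj-↭ p ⟫ disj-↭ q

conj-cons : ∀ α φ → conj (α ∷ φ) ≈ α ∧ conj φ
conj-cons α []      = ≈-sym ∧-unit
conj-cons α (_ ∷ _) = ≈-refl

conj-++ : ∀ φ ψ → conj (φ ++ ψ) ≈ conj φ ∧ conj ψ
conj-++ []      ψ = ≈-sym (∧-comm ⟫ ∧-unit)
conj-++ (α ∷ φ) ψ = begin
  conj (α ∷ φ ++ ψ)          ≈⟨ conj-cons α (φ ++ ψ) ⟩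
  α ∧ conj (φ ++ ψ)          ≈⟨ ∧-cong ≈-refl (conj-++ φ ψ) ⟩
  α ∧ (conj φ ∧ conj ψ)      ≈⟨ ≈-sym ∧-assoc ⟩
  (α ∧ conj φ) ∧ conj ψ      ≈⟨ ∧-cong (≈-sym (conj-cons α φ)) ≈-refl ⟩
  conj (α ∷ φ) ∧ conj ψ      ∎
  where open ≈-Reasoning

premisses-++ : ∀ P Q → conj (map disj (P ++ Q)) ≈ conj (map disj P) ∧ conj (map disj Q)
premisses-++ P Q rewrite map-++ disj P Q = conj-++ (map disj P) (map disj Q)

≈-plug : ∀ ξ → α ≈ β → plug ξ α ≈ plug ξ β
≈-plug □        e = e
≈-plug (ξ ∨ˡ _) e = ∨-cong (≈-plug ξ e) ≈-refl
≈-plug (_ ∨ʳ ξ) e = ∨-cong ≈-refl (≈-plug ξ e)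
≈-plug (ξ ∧ˡ _) e = ∧-cong (≈-plug ξ e) ≈-refl
≈-plug (_ ∧ʳ ξ) e = ∧-cong ≈-refl (≈-plug ξ e)

_∘ᶜ_ : Ctx → Ctx → Ctx
□        ∘ᶜ ζ = ζ
(ξ ∨ˡ β) ∘ᶜ ζ = (ξ ∘ᶜ ζ) ∨ˡ β
(α ∨ʳ ξ) ∘ᶜ ζ = α ∨ʳ (ξ ∘ᶜ ζ)
(ξ ∧ˡ β) ∘ᶜ ζ = (ξ ∘ᶜ ζ) ∧ˡ β
(α ∧ʳ ξ) ∘ᶜ ζ = α ∧ʳ (ξ ∘ᶜ ζ)

plug-∘ᶜ : ∀ ξ ζ γ → plug (ξ ∘ᶜ ζ) γ ≡ plug ξ (plug ζ γ)
plug-∘ᶜ □        ζ γ = refl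
plug-∘ᶜ (ξ ∨ˡ β) ζ γ = cong (_∨ β) (plug-∘ᶜ ξ ζ γ)
plug-∘ᶜ (α ∨ʳ ξ) ζ γ = cong (α ∨_) (plug-∘ᶜ ξ ζ γ)
plug-∘ᶜ (ξ ∧ˡ β) ζ γ = cong (_∧ β) (plug-∘ᶜ ξ ζ γ)
plug-∘ᶜ (α ∧ʳ ξ) ζ γ = cong (α ∧_) (plug-∘ᶜ ξ ζ γ)

module _ {S : List Rule} where

  infixr 5 _⊕_

  _⊕_ : Deriv S α β → Deriv S β γ → Deriv S α γ
  done e     ⊕ done e'      = done (e ⟫ e')
  done e     ⊕ more e' s d  = more (e ⟫ e') s d
  more e s d ⊕ d'           = more e s (d ⊕ d')

  one : Step S α β → Deriv S α β
  one s = more ≈-refl s (done ≈-refl)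

  liftStep : ∀ ξ → Step S α β → Step S (plug ξ α) (plug ξ β)
  liftStep ξ (step r m ρ σ ζ) =
    subst₂ (Step S) (plug-∘ᶜ ξ ζ _) (plug-∘ᶜ ξ ζ _) (step r m ρ σ (ξ ∘ᶜ ζ))

  liftStep-rule : ∀ ξ (s : Step S α β) → stepRule (liftStep ξ s) ≡ stepRule s
  liftStep-rule ξ (step r m ρ σ ζ) = transport-rule (plug-∘ᶜ ξ ζ _) (plug-∘ᶜ ξ ζ _)
    where
    transport-rule : ∀ {α α' β β'} (p : α ≡ α') (q : β ≡ β') {s : Step S α β} →
                     stepRule (subst₂ (Step S) p q s) ≡ stepRule s
    transport-rule refl refl = refl

  lift : ∀ ξ → Deriv S α β → Deriv S (plug ξ α) (plug ξ β)
  lift ξ (done e)     = done (≈-plug ξ e)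
  lift ξ (more e s d) = more (≈-plug ξ e) (liftStep ξ s) (lift ξ d)

  par : Deriv S α β → Deriv S γ δ → Deriv S (α ∧ γ) (β ∧ δ)
  par {β = β} {γ = γ} d₁ d₂ = lift (□ ∧ˡ γ) d₁ ⊕ lift (β ∧ʳ □) d₂

  steps : Deriv S α β → ℕ
  steps (done _)     = 0
  steps (more _ _ d) = suc (steps d)

  steps-⊕ : (d : Deriv S α β) (d' : Deriv S β γ) → steps (d ⊕ d') ≡ steps d + steps d'
  steps-⊕ (done e)     (done e')     = refl
  steps-⊕ (done e)     (more e' s d) = refl
  steps-⊕ (more e s d) d'            = cong suc (steps-⊕ d d')

  steps-lift : ∀ ξ (d : Deriv S α β) → steps (lift ξ d) ≡ steps d
  steps-lift ξ (done _)     = refl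
  steps-lift ξ (more _ _ d) = cong suc (steps-lift ξ d)

  steps-par : (d₁ : Deriv S α β) (d₂ : Deriv S γ δ) → steps (par d₁ d₂) ≡ steps d₁ + steps d₂
  steps-par {β = β} {γ = γ} d₁ d₂ =
    Eq.trans (steps-⊕ (lift (□ ∧ˡ γ) d₁) (lift (β ∧ʳ □) d₂))
             (Eq.cong₂ _+_ (steps-lift (□ ∧ˡ γ) d₁) (steps-lift (β ∧ʳ □) d₂))

  -- every formula of the chain (exactly those counted by dsize) satisfies F
  Every : (Fm → Set) → Deriv S α β → Set
  Every F (done {α} {β} _)     = F α × F β
  Every F (more {α} {β} _ _ d) = F α × F β × Every F d

  every-first : ∀ {F} (d : Deriv S α β) → Every F d → F α
  every-first (done _)     (a , _) = a
  every-first (more _ _ _) (a , _) = a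

  every-last : ∀ {F} (d : Deriv S α β) → Every F d → F β
  every-last (done _)     (_ , b)     = b
  every-last (more _ _ d) (_ , _ , h) = every-last d h

  every-mono : ∀ {F G : Fm → Set} → (∀ {α} → F α → G α) → (d : Deriv S α β) → Every F d → Every G d
  every-mono f (done _)     (a , b)     = f a , f b
  every-mono f (more _ _ d) (a , b , h) = f a , f b , every-mono f d h

  every-⊕ : ∀ {F} (d : Deriv S α β) (d' : Deriv S β γ) → Every F d → Every F d' → Every F (d ⊕ d')
  every-⊕ (done _)     (done _)     (a , _)     (_ , c)     = a , c
  every-⊕ (done _)     (more _ _ _) (a , _)     (_ , c , h) = a , c , h
  every-⊕ (more _ _ d) d'           (a , b , h) h'          = a , b , every-⊕ d d' h h'

  every-lift : ∀ {F} ξ (d : Deriv S α β) → Every (λ G → F (plug ξ G)) d → Every F (lift ξ d)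
  every-lift ξ (done _)     (a , b)     = a , b
  every-lift ξ (more _ _ d) (a , b , h) = a , b , every-lift ξ d h

  every-par : ∀ {m n} (d₁ : Deriv S α β) (d₂ : Deriv S γ δ) →
              Every (λ F → fsize F ≤ m) d₁ → Every (λ F → fsize F ≤ n) d₂ →
              Every (λ F → fsize F ≤ m + n) (par d₁ d₂)
  every-par {β = β} {γ = γ} d₁ d₂ h₁ h₂ = every-⊕ (lift (□ ∧ˡ γ) d₁) (lift (β ∧ʳ □) d₂)
    (every-lift (□ ∧ˡ γ) d₁ (every-mono (λ h → +-mono-≤ h (every-first d₂ h₂)) d₁ h₁))
    (every-lift (β ∧ʳ □) d₂ (every-mono (λ h → +-mono-≤ (every-last d₁ h₁) h) d₂ h₂))

  dsize-bound : ∀ {M} (d : Deriv S α β) → Every (λ F → fsize F ≤ M) d → dsize d ≤ (steps d + 1) * (M + M)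
  dsize-bound {M = M} (done _) (a , b) = ≤-trans (+-mono-≤ a b) (≤-reflexive (sym (+-identityʳ (M + M))))
  dsize-bound (more _ _ d) (a , b , h) = +-mono-≤ (+-mono-≤ a b) (dsize-bound d h)

  rules-⊕ : ∀ {T} (d : Deriv S α β) (d' : Deriv S β γ) → RulesIn T d → RulesIn T d' → RulesIn T (d ⊕ d')
  rules-⊕ (done _)     (done _)     _       _ = tt
  rules-⊕ (done _)     (more _ _ _) _       r = r
  rules-⊕ (more _ _ d) d'           (m , r) r' = m , rules-⊕ d d' r r'

  rules-lift : ∀ {T} ξ (d : Deriv S α β) → RulesIn T d → RulesIn T (lift ξ d)
  rules-lift ξ (done _)         _       = tt
  rules-lift {T = T} ξ (more _ s d) (m , r) = Eq.subst (_∈ T) (sym (liftStep-rule ξ s)) m , rules-lift ξ d r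

  rules-par : ∀ {T} (d₁ : Deriv S α β) (d₂ : Deriv S γ δ) → RulesIn T d₁ → RulesIn T d₂ → RulesIn T (par d₁ d₂)
  rules-par {β = β} {γ = γ} d₁ d₂ r₁ r₂ =
    rules-⊕ (lift (□ ∧ˡ γ) d₁) (lift (β ∧ʳ □) d₂) (rules-lift (□ ∧ˡ γ) d₁ r₁) (rules-lift (β ∧ʳ □) d₂ r₂)

identity↓ weakening↓ contraction↓ switch cut↑ : Rule
identity↓    = 𝕥 / (vA ∨ vĀ)
weakening↓   = 𝕗 / vA
contraction↓ = (vA ∨ vA) / vA
switch       = (vA ∧ (vB ∨ vC)) / ((vA ∧ vB) ∨ vC)
cut↑         = (vA ∧ vĀ) / 𝕗

identity↓∈ : identity↓ ∈ KSg
identity↓∈ = here refl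

weakening↓∈ : weakening↓ ∈ KSg
weakening↓∈ = there (here refl)

contraction↓∈ : contraction↓ ∈ KSg
contraction↓∈ = there (there (here refl))

switch∈ : switch ∈ KSg
switch∈ = there (there (there (here refl)))

cut↑∈ : cut↑ ∈ SKSg
cut↑∈ = there (there (there (there (here refl))))

-- the substitution A ↦ α, B ↦ β, C ↦ γ (the rules mention no other variables)
⟨_,_,_⟩ : Fm → Fm → Fm → Substitution
⟨ α , β , γ ⟩ 0 = α
⟨ α , β , γ ⟩ 1 = β
⟨ α , β , γ ⟩ _ = γ

apply : ∀ {r} → r ∈ SKSg → (σ : Substitution) (ξ : Ctx) →
        Deriv SKSg (plug ξ (inst pos σ (prem r))) (plug ξ (inst pos σ (concl r)))
apply m σ ξ = one (step _ m pos σ ξ)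

applyK : ∀ {r} → r ∈ KSg → (σ : Substitution) (ξ : Ctx) →
         Deriv SKSg (plug ξ (inst pos σ (prem r))) (plug ξ (inst pos σ (concl r)))
applyK m = apply (∈-++⁺ˡ m)

weaken : ∀ φ A → Deriv SKSg (disj φ) (disj (φ ++ A ∷ []))
weaken φ A = done (≈-sym ∨-unit)
           ⊕ applyK weakening↓∈ ⟨ A , A , A ⟩ (disj φ ∨ʳ □)
           ⊕ done (≈-sym (disj-++ φ (A ∷ [])))

weaken-every : ∀ φ A → Every (λ F → fsize F ≤ ssize (φ ++ A ∷ []) + 1) (weaken φ A)
weaken-every φ A =
  ≤-trans (m≤m+n (fsize (disj φ)) (fsize A)) side ,
  ≤-trans (+-monoʳ-≤ (fsize (disj φ)) (fsize-pos A)) side ,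
  side ,
  disj-size (φ ++ A ∷ [])
  where side = split-size φ A []

contract : ∀ φ A → Deriv SKSg (disj (φ ++ A ∷ A ∷ [])) (disj (φ ++ A ∷ []))
contract φ A = done (disj-++ φ (A ∷ A ∷ []))
             ⊕ applyK contraction↓∈ ⟨ A , A , A ⟩ (disj φ ∨ʳ □)
             ⊕ done (≈-sym (disj-++ φ (A ∷ [])))

contract-every : ∀ φ A → Every (λ F → fsize F ≤ ssize (φ ++ A ∷ A ∷ []) + 1) (contract φ A)
contract-every φ A =
  disj-size (φ ++ A ∷ A ∷ []) ,
  side ,
  ≤-trans (+-monoʳ-≤ (fsize (disj φ)) (m≤n+m (fsize A) (fsize A))) side ,
  ≤-trans (disj-size (φ ++ A ∷ [])) (+-monoˡ-≤ 1 shorter)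
  where
  side = split-size φ A (A ∷ [])
  shorter : ssize (φ ++ A ∷ []) ≤ ssize (φ ++ A ∷ A ∷ [])
  shorter rewrite ssize-++ φ (A ∷ []) | ssize-++ φ (A ∷ A ∷ []) =
    +-monoʳ-≤ (ssize φ) (m≤n+m (fsize A + 0) (fsize A))

-- the conjunction rule by two switches:
--   ([X ∨ A] ∧ [B ∨ Y])  =  ([B ∨ Y] ∧ [A ∨ X])  →  [([B ∨ Y] ∧ A) ∨ X]
--                        =  [(A ∧ [B ∨ Y]) ∨ X]  →  [[(A ∧ B) ∨ Y] ∨ X]  =  [X ∨ (A ∧ B) ∨ Y]
switch₂ : ∀ X A B Y → Deriv SKSg ((X ∨ A) ∧ (B ∨ Y)) (X ∨ ((A ∧ B) ∨ Y))
switch₂ X A B Y = done (∧-comm ⟫ ∧-cong ≈-refl ∨-comm)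
                ⊕ applyK switch∈ ⟨ B ∨ Y , A , X ⟩ □
                ⊕ done (∨-cong ∧-comm ≈-refl)
                ⊕ applyK switch∈ ⟨ A , B , Y ⟩ (□ ∨ˡ X)
                ⊕ done ∨-comm

-- switching only rearranges the four parts, so no formula grows
switch₂-every : ∀ X A B Y → Every (λ F → fsize F ≤ fsize ((X ∨ A) ∧ (B ∨ Y))) (switch₂ X A B Y)
switch₂-every X A B Y =
  ≤-refl ,
  ≤-reflexive (shape₁ x a b y) ,
  ≤-reflexive (shape₂ x a b y) ,
  ≤-reflexive (shape₃ x a b y) ,
  ≤-reflexive (shape₄ x a b y) ,
  ≤-reflexive (shape₅ x a b y)
  where
  x = fsize X ; a = fsize A ; b = fsize B ; y = fsize Y
  shape₁ : ∀ x a b y → b + y + (a + x) ≡ x + a + (b + y)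
  shape₁ = solve-∀
  shape₂ : ∀ x a b y → b + y + a + x ≡ x + a + (b + y)
  shape₂ = solve-∀
  shape₃ : ∀ x a b y → a + (b + y) + x ≡ x + a + (b + y)
  shape₃ = solve-∀
  shape₄ : ∀ x a b y → a + b + y + x ≡ x + a + (b + y)
  shape₄ = solve-∀
  shape₅ : ∀ x a b y → x + (a + b + y) ≡ x + a + (b + y)
  shape₅ = solve-∀

cut-core : ∀ X A Y → Deriv SKSg ((X ∨ A) ∧ (dual A ∨ Y)) (X ∨ (𝕗 ∨ Y))
cut-core X A Y = switch₂ X A (dual A) Y ⊕ apply cut↑∈ ⟨ A , A , A ⟩ (X ∨ʳ (□ ∨ˡ Y))

cut-core-every : ∀ X A Y → Every (λ F → fsize F ≤ fsize ((X ∨ A) ∧ (dual A ∨ Y))) (cut-core X A Y)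
cut-core-every X A Y =
  every-⊕ {F = λ G → fsize G ≤ fsize ((X ∨ A) ∧ (dual A ∨ Y))}
    (switch₂ X A (dual A) Y) (apply cut↑∈ ⟨ A , A , A ⟩ (X ∨ʳ (□ ∨ˡ Y)))
    (switch₂-every X A (dual A) Y) (same , same , smaller , smaller)
  where
  x = fsize X ; a = fsize A ; ā = fsize (dual A) ; y = fsize Y
  shape : ∀ x a ā y → x + (a + ā + y) ≡ x + a + (ā + y)
  shape = solve-∀
  same : x + (a + ā + y) ≤ x + a + (ā + y)
  same = ≤-reflexive (shape x a ā y)
  smaller : x + (1 + y) ≤ x + a + (ā + y)
  smaller = ≤-trans (+-monoʳ-≤ x (+-monoˡ-≤ y (≤-trans (fsize-pos A) (m≤m+n a ā)))) same

binary : ∀ {α α₁ α₂ β₁ β₂ γ₁ γ₂ δ} → α ≈ α₁ ∧ α₂ → Deriv SKSg α₁ β₁ → Deriv SKSg α₂ β₂ →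
         β₁ ∧ β₂ ≈ γ₁ → Deriv SKSg γ₁ γ₂ → γ₂ ≈ δ → Deriv SKSg α δ
binary e₀ d₁ d₂ e₁ core e₂ = done e₀ ⊕ par d₁ d₂ ⊕ done e₁ ⊕ core ⊕ done e₂

binary-steps : ∀ {α α₁ α₂ β₁ β₂ γ₁ γ₂ δ} (e₀ : α ≈ α₁ ∧ α₂) (d₁ : Deriv SKSg α₁ β₁) (d₂ : Deriv SKSg α₂ β₂)
  (e₁ : β₁ ∧ β₂ ≈ γ₁) (core : Deriv SKSg γ₁ γ₂) (e₂ : γ₂ ≈ δ) →
  steps (binary e₀ d₁ d₂ e₁ core e₂) ≡ steps d₁ + steps d₂ + steps core
binary-steps e₀ d₁ d₂ e₁ core e₂ = begin
  steps (done e₀ ⊕ par d₁ d₂ ⊕ rest)  ≡⟨ steps-⊕ (done e₀) (par d₁ d₂ ⊕ rest) ⟩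
  steps (par d₁ d₂ ⊕ rest)            ≡⟨ steps-⊕ (par d₁ d₂) rest ⟩
  steps (par d₁ d₂) + steps rest      ≡⟨ Eq.cong₂ _+_ (steps-par d₁ d₂) steps-rest ⟩
  steps d₁ + steps d₂ + steps core    ∎
  where
  open Eq.≡-Reasoning
  rest = done e₁ ⊕ core ⊕ done e₂
  steps-rest : steps rest ≡ steps core
  steps-rest = Eq.trans (steps-⊕ (done e₁) (core ⊕ done e₂))
                        (Eq.trans (steps-⊕ core (done e₂)) (+-identityʳ (steps core)))

binary-rules : ∀ {T α α₁ α₂ β₁ β₂ γ₁ γ₂ δ} (e₀ : α ≈ α₁ ∧ α₂) (d₁ : Deriv SKSg α₁ β₁) (d₂ : Deriv SKSg α₂ β₂)
  (e₁ : β₁ ∧ β₂ ≈ γ₁) (core : Deriv SKSg γ₁ γ₂) (e₂ : γ₂ ≈ δ) →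
  RulesIn T d₁ → RulesIn T d₂ → RulesIn T core → RulesIn T (binary e₀ d₁ d₂ e₁ core e₂)
binary-rules e₀ d₁ d₂ e₁ core e₂ r₁ r₂ r =
  rules-⊕ (done e₀) (par d₁ d₂ ⊕ rest) tt
    (rules-⊕ (par d₁ d₂) rest (rules-par d₁ d₂ r₁ r₂)
      (rules-⊕ (done e₁) (core ⊕ done e₂) tt (rules-⊕ core (done e₂) r tt)))
  where rest = done e₁ ⊕ core ⊕ done e₂

binary-every : ∀ {P Q φ A C ψ γ χ g₁ g₂}
  (e₀ : conj (map disj (P ++ Q)) ≈ conj (map disj P) ∧ conj (map disj Q))
  (d₁ : Deriv SKSg (conj (map disj P)) (disj (φ ++ A ∷ [])))
  (d₂ : Deriv SKSg (conj (map disj Q)) (disj (C ∷ ψ)))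
  (e₁ : disj (φ ++ A ∷ []) ∧ disj (C ∷ ψ) ≈ (disj φ ∨ A) ∧ (C ∨ disj ψ))
  (core : Deriv SKSg ((disj φ ∨ A) ∧ (C ∨ disj ψ)) γ) (e₂ : γ ≈ disj χ) →
  Every (λ F → fsize F + ssize (φ ++ A ∷ []) ≤ 2 * g₁ + 1) d₁ →
  Every (λ F → fsize F + ssize (C ∷ ψ) ≤ 2 * g₂ + 1) d₂ →
  ssize (φ ++ A ∷ []) ≤ g₁ → ssize (C ∷ ψ) ≤ g₂ →
  Every (λ F → fsize F ≤ fsize ((disj φ ∨ A) ∧ (C ∨ disj ψ))) core →
  Every (λ F → fsize F + ssize χ ≤ 2 * (ssize χ + g₁ + g₂) + 1) (binary e₀ d₁ d₂ e₁ core e₂)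
binary-every {P} {Q} {φ} {A} {C} {ψ} {χ = χ} {g₁} {g₂} e₀ d₁ d₂ e₁ core e₂ h₁ h₂ s₁≤g₁ s₂≤g₂ hc =
  every-⊕ (done e₀) (par d₁ d₂ ⊕ rest) (premiss , every-first (par d₁ d₂) hpar)
    (every-⊕ (par d₁ d₂) rest hpar
      (every-⊕ (done e₁) (core ⊕ done e₂) (every-last (par d₁ d₂) hpar , every-first core hcore)
        (every-⊕ core (done e₂) hcore (every-last core hcore , final))))
  where
  s = ssize χ
  rest = done e₁ ⊕ core ⊕ done e₂
  Fits : Fm → Set
  Fits F = fsize F + s ≤ 2 * (s + g₁ + g₂) + 1
  -- everything before the conclusion has size ≤ 2g₁ + 2g₂, which fits
  inner : ∀ {F} → fsize F ≤ 2 * g₁ + 2 * g₂ → Fits F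
  inner h = fits₂ s g₁ g₂ (≤-trans h (≤-trans (m≤n+m _ s) (m≤m+n _ 1)))
  small₁ : Every (λ F → fsize F ≤ 2 * g₁) d₁
  small₁ = every-mono (drop-credit g₁ (nonempty-size φ A [])) d₁ h₁
  small₂ : Every (λ F → fsize F ≤ 2 * g₂) d₂
  small₂ = every-mono (drop-credit g₂ (nonempty-size [] C ψ)) d₂ h₂
  hpar : Every Fits (par d₁ d₂)
  hpar = every-mono (λ {G} → inner {G}) (par d₁ d₂) (every-par d₁ d₂ small₁ small₂)
  premiss : Fits (conj (map disj (P ++ Q)))
  premiss = inner {conj (map disj (P ++ Q))}
    (≤-trans (premisses-size P Q) (+-mono-≤ (every-first d₁ small₁) (every-first d₂ small₂)))
  right-size : fsize (C ∨ disj ψ) ≤ ssize (C ∷ ψ) + 1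
  right-size = ≤-trans (+-monoʳ-≤ (fsize C) (disj-size ψ)) (≤-reflexive (sym (+-assoc (fsize C) (ssize ψ) 1)))
  core-size : fsize ((disj φ ∨ A) ∧ (C ∨ disj ψ)) ≤ 2 * g₁ + 2 * g₂
  core-size = +-mono-≤ (≤-trans (split-size φ A []) (side≤ (nonempty-size φ A []) s₁≤g₁))
                       (≤-trans right-size (side≤ (nonempty-size [] C ψ) s₂≤g₂))
  hcore : Every Fits core
  hcore = every-mono (λ {G} h → inner {G} (≤-trans h core-size)) core hc
  final : Fits (disj χ)
  final = fits₂ s g₁ g₂ (≤-trans (disj-size χ) (+-monoˡ-≤ 1 (m≤m+n s _)))

regroup : ∀ φ A C ψ → disj (φ ++ A ∷ []) ∧ disj (C ∷ ψ) ≈ (disj φ ∨ A) ∧ (C ∨ disj ψ)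
regroup φ A C ψ = ∧-cong (disj-++ φ (A ∷ [])) (disj-cons C ψ)

con-conclusion : ∀ φ A B ψ → disj φ ∨ ((A ∧ B) ∨ disj ψ) ≈ disj (φ ++ (A ∧ B) ∷ ψ)
con-conclusion φ A B ψ = ∨-cong ≈-refl (≈-sym (disj-cons (A ∧ B) ψ)) ⟫ ≈-sym (disj-++ φ ((A ∧ B) ∷ ψ))

cut-conclusion : ∀ φ ψ → disj φ ∨ (𝕗 ∨ disj ψ) ≈ disj (φ ++ ψ)
cut-conclusion φ ψ = ∨-cong ≈-refl (∨-comm ⟫ ∨-unit) ⟫ ≈-sym (disj-++ φ ψ)

translate : ∀ {P ψ} → GD P ψ → Deriv SKSg (conj (map disj P)) (disj ψ)
translate (leaf φ)                = done ≈-refl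
translate (ax A)                  = applyK identity↓∈ ⟨ A , A , A ⟩ □
translate tru                     = done ≈-refl
translate (wk {φ = φ} A d)        = translate d ⊕ weaken φ A
translate (ctr {φ = φ} A d)       = translate d ⊕ contract φ A
translate (dis {φ = φ} A B d)     =
  translate d ⊕ done (disj-++ φ (A ∷ B ∷ []) ⟫ ≈-sym (disj-++ φ ((A ∨ B) ∷ [])))
translate (con {P} {Q} {φ} {ψ} A B d e) =
  binary (premisses-++ P Q) (translate d) (translate e) (regroup φ A B ψ)
         (switch₂ (disj φ) A B (disj ψ)) (con-conclusion φ A B ψ)
translate (cut {P} {Q} {φ} {ψ} A d e) =
  binary (premisses-++ P Q) (translate d) (translate e) (regroup φ A (dual A) ψ)
         (cut-core (disj φ) A (disj ψ)) (cut-conclusion φ ψ)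
translate (exch p d)              = translate d ⊕ done (disj-↭ p)

translate-analytic : ∀ {P ψ} (Δ : GD P ψ) → Analytic Δ → RulesIn KSg (translate Δ)
translate-analytic (leaf _)              _          = tt
translate-analytic (ax _)                _          = identity↓∈ , tt
translate-analytic tru                   _          = tt
translate-analytic (wk {φ = φ} A d)      a          =
  rules-⊕ (translate d) (weaken φ A) (translate-analytic d a) (weakening↓∈ , tt)
translate-analytic (ctr {φ = φ} A d)     a          =
  rules-⊕ (translate d) (contract φ A) (translate-analytic d a) (contraction↓∈ , tt)
translate-analytic (dis A B d)           a          = rules-⊕ (translate d) (done _) (translate-analytic d a) tt
translate-analytic (con {P} {Q} {φ} {ψ} A B d e) (a₁ , a₂) =
  binary-rules (premisses-++ P Q) (translate d) (translate e) (regroup φ A B ψ)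
               (switch₂ (disj φ) A B (disj ψ)) (con-conclusion φ A B ψ)
               (translate-analytic d a₁) (translate-analytic e a₂) (switch∈ , switch∈ , tt)
translate-analytic (cut _ _ _)           ()
translate-analytic (exch p d)            a          = rules-⊕ (translate d) (done _) (translate-analytic d a) tt

conclusion-size : ∀ {P ψ} (Δ : GD P ψ) → ssize ψ ≤ gsize Δ
conclusion-size (leaf _)      = ≤-refl
conclusion-size (ax _)        = ≤-refl
conclusion-size tru           = ≤-refl
conclusion-size (wk _ d)      = m≤m+n _ (gsize d)
conclusion-size (ctr _ d)     = m≤m+n _ (gsize d)
conclusion-size (dis _ _ d)   = m≤m+n _ (gsize d)
conclusion-size (con _ _ d e) = ≤-trans (m≤m+n _ (gsize d)) (m≤m+n _ (gsize e))
conclusion-size (cut _ d e)   = ≤-trans (m≤m+n _ (gsize d)) (m≤m+n _ (gsize e))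
conclusion-size (exch p d)    = ≤-trans (≤-reflexive (sym (ssize-↭ p))) (conclusion-size d)

unary-steps : ∀ {s g} (d : Deriv SKSg α β) (core : Deriv SKSg β γ) → steps core ≤ 1 →
              steps d ≤ 4 * g → 1 ≤ s → steps (d ⊕ core) + 2 * s ≤ 4 * (s + g)
unary-steps {s = s} d core k≤1 h 1≤s = begin
  steps (d ⊕ core) + 2 * s     ≡⟨ cong (_+ 2 * s) (steps-⊕ d core) ⟩
  steps d + steps core + 2 * s ≤⟨ +-monoˡ-≤ (2 * s) (+-monoʳ-≤ (steps d) k≤1) ⟩
  steps d + 1 + 2 * s          ≤⟨ unary-credit h 1≤s ⟩
  4 * (s + _)                  ∎
  where open ≤-Reasoning

translate-steps : ∀ {P ψ} (Δ : GD P ψ) → steps (translate Δ) + 2 * ssize ψ ≤ 4 * gsize Δ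
translate-steps (leaf φ)          = *-monoˡ-≤ (ssize φ) (m≤m+n 2 2)
translate-steps (ax A)            =
  ≤-trans (unary-credit {t = 0} {g = 0} z≤n (nonempty-size [] A (dual A ∷ [])))
          (≤-reflexive (cong (4 *_) (+-identityʳ (ssize (A ∷ dual A ∷ [])))))
translate-steps tru               = m≤m+n 2 2
translate-steps (wk {φ = φ} A d)  =
  unary-steps (translate d) (weaken φ A) ≤-refl (m+n≤o⇒m≤o _ (translate-steps d)) (nonempty-size φ A [])
translate-steps (ctr {φ = φ} A d) =
  unary-steps (translate d) (contract φ A) ≤-refl (m+n≤o⇒m≤o _ (translate-steps d)) (nonempty-size φ A [])
translate-steps (dis {φ = φ} A B d) =
  unary-steps (translate d) (done _) z≤n (m+n≤o⇒m≤o _ (translate-steps d)) (nonempty-size φ (A ∨ B) [])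
translate-steps (con {P} {Q} {φ} {ψ} A B d e) =
  ≤-trans (≤-reflexive (cong (_+ _) (binary-steps (premisses-++ P Q) (translate d) (translate e)
            (regroup φ A B ψ) (switch₂ (disj φ) A B (disj ψ)) (con-conclusion φ A B ψ))))
          (binary-credit (steps (translate d)) (steps (translate e)) (ssize (φ ++ (A ∧ B) ∷ ψ)) (gsize d) (gsize e)
            (translate-steps d) (translate-steps e) (nonempty-size φ A []) (nonempty-size [] B ψ) (n≤1+n 2))
translate-steps (cut {P} {Q} {φ} {ψ} A d e) =
  ≤-trans (≤-reflexive (cong (_+ _) (binary-steps (premisses-++ P Q) (translate d) (translate e)
            (regroup φ A (dual A) ψ) (cut-core (disj φ) A (disj ψ)) (cut-conclusion φ ψ))))
          (binary-credit (steps (translate d)) (steps (translate e)) (ssize (φ ++ ψ)) (gsize d) (gsize e)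
            (translate-steps d) (translate-steps e) (nonempty-size φ A []) (nonempty-size [] (dual A) ψ) ≤-refl)
translate-steps (exch {φ = φ} {ψ} p d) = begin
  steps (translate d ⊕ done (disj-↭ p)) + 2 * ssize ψ ≡⟨ Eq.cong₂ _+_ steps-same (cong (2 *_) (sym (ssize-↭ p))) ⟩
  steps (translate d) + 2 * ssize φ                   ≤⟨ translate-steps d ⟩
  4 * gsize d                                         ∎
  where
  open ≤-Reasoning
  steps-same = Eq.trans (steps-⊕ (translate d) (done (disj-↭ p))) (+-identityʳ _)

unary-every : ∀ {s₀} s g (d : Deriv SKSg α β) (core : Deriv SKSg β γ) →
              Every (λ F → fsize F + s₀ ≤ 2 * g + 1) d → Every (λ F → fsize F ≤ s + 2 * g + 1) core →
              Every (λ F → fsize F + s ≤ 2 * (s + g) + 1) (d ⊕ core)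
unary-every s g d core hd hc =
  every-⊕ d core (every-mono (λ {F} h → fits₁ s g (grow (m+n≤o⇒m≤o (fsize F) h))) d hd)
                 (every-mono (fits₁ s g) core hc)
  where
  grow : ∀ {x} → x ≤ 2 * g + 1 → x ≤ s + 2 * g + 1
  grow h = ≤-trans h (+-monoˡ-≤ 1 (m≤n+m (2 * g) s))

from-conclusion : ∀ {x} s g → x ≤ s + 1 → x ≤ s + 2 * g + 1
from-conclusion s g h = ≤-trans h (+-monoˡ-≤ 1 (m≤m+n s (2 * g)))

from-premiss : ∀ {x s₀} s g → x ≤ s₀ + 1 → s₀ ≤ g → x ≤ s + 2 * g + 1
from-premiss s g h s₀≤g =
  ≤-trans h (+-monoˡ-≤ 1 (≤-trans s₀≤g (≤-trans (m≤m+n g (g + 0)) (m≤n+m (2 * g) s))))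

translate-every : ∀ {P ψ} (Δ : GD P ψ) → Every (λ F → fsize F + ssize ψ ≤ 2 * gsize Δ + 1) (translate Δ)
translate-every (leaf φ) = fit , fit
  where fit = fits₀ (ssize φ) (disj-size φ)
translate-every (ax A) = unit , unit , axiom , axiom
  where
  s = ssize (A ∷ dual A ∷ [])
  unit = fits₀ s (m≤n+m 1 s)
  axiom = fits₀ s (disj-size (A ∷ dual A ∷ []))
translate-every tru = n≤1+n 2 , n≤1+n 2
translate-every (wk {φ = φ} A d) =
  unary-every (ssize (φ ++ A ∷ [])) (gsize d) (translate d) (weaken φ A) (translate-every d)
    (every-mono (λ {G} → from-conclusion {fsize G} (ssize (φ ++ A ∷ [])) (gsize d)) (weaken φ A) (weaken-every φ A))
translate-every (ctr {φ = φ} A d) =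
  unary-every (ssize (φ ++ A ∷ [])) (gsize d) (translate d) (contract φ A) (translate-every d)
    (every-mono (λ {G} h → from-premiss {fsize G} (ssize (φ ++ A ∷ [])) (gsize d) h (conclusion-size d))
                (contract φ A) (contract-every φ A))
translate-every (dis {φ = φ} A B d) =
  unary-every (ssize (φ ++ (A ∨ B) ∷ [])) (gsize d) (translate d) (done _) (translate-every d)
    (from-premiss (ssize (φ ++ (A ∨ B) ∷ [])) (gsize d) (disj-size (φ ++ A ∷ B ∷ [])) (conclusion-size d) ,
     from-conclusion (ssize (φ ++ (A ∨ B) ∷ [])) (gsize d) (disj-size (φ ++ (A ∨ B) ∷ [])))
translate-every (con {P} {Q} {φ} {ψ} A B d e) =
  binary-every {P} {Q} {φ} {A} {B} {ψ} {χ = φ ++ (A ∧ B) ∷ ψ} {g₁ = gsize d} {g₂ = gsize e}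
               (premisses-++ P Q) (translate d) (translate e) (regroup φ A B ψ)
               (switch₂ (disj φ) A B (disj ψ)) (con-conclusion φ A B ψ)
               (translate-every d) (translate-every e) (conclusion-size d) (conclusion-size e)
               (switch₂-every (disj φ) A B (disj ψ))
translate-every (cut {P} {Q} {φ} {ψ} A d e) =
  binary-every {P} {Q} {φ} {A} {dual A} {ψ} {χ = φ ++ ψ} {g₁ = gsize d} {g₂ = gsize e}
               (premisses-++ P Q) (translate d) (translate e) (regroup φ A (dual A) ψ)
               (cut-core (disj φ) A (disj ψ)) (cut-conclusion φ ψ)
               (translate-every d) (translate-every e) (conclusion-size d) (conclusion-size e)
               (cut-core-every (disj φ) A (disj ψ))
translate-every (exch {φ = φ} {ψ} p d) =
  every-⊕ (translate d) (done (disj-↭ p)) (every-mono (Eq.subst (λ t → _ + t ≤ _) (ssize-↭ p)) (translate d) hd)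
    (Eq.subst (λ t → _ + t ≤ _) (ssize-↭ p) (every-last (translate d) hd) , final)
  where
  hd = translate-every d
  final : fsize (disj ψ) + ssize ψ ≤ 2 * gsize d + 1
  final = ≤-trans (fits₀ (ssize ψ) (disj-size ψ))
                  (+-monoˡ-≤ 1 (*-monoʳ-≤ 2 (≤-trans (≤-reflexive (sym (ssize-↭ p))) (conclusion-size d))))

theorem3p4 : Σ ℕ λ c → ∀ {P ψ} (Δ : GD P ψ) →
    Σ (Deriv SKSg (conj (map disj P)) (disj ψ)) λ Φ →
      (dsize Φ ≤ c * (gsize Δ * gsize Δ) + c) × (Analytic Δ → RulesIn KSg Φ)
theorem3p4 = 28 , λ Δ → translate Δ , size-bound Δ , translate-analytic Δ
  where
  size-bound : ∀ {P ψ} (Δ : GD P ψ) → dsize (translate Δ) ≤ 28 * (gsize Δ * gsize Δ) + 28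
  size-bound Δ = begin
    dsize (translate Δ)                  ≤⟨ dsize-bound (translate Δ) width ⟩
    (steps (translate Δ) + 1) * (M + M)  ≤⟨ *-monoˡ-≤ (M + M) (+-monoˡ-≤ 1 length) ⟩
    (4 * n + 1) * (M + M)                ≤⟨ quadratic n ⟩
    28 * (n * n) + 28                    ∎
    where
    open ≤-Reasoning
    n = gsize Δ
    M = 2 * n + 1
    -- forget the credits of the conclusion in both invariants
    width : Every (λ F → fsize F ≤ M) (translate Δ)
    width = every-mono (m+n≤o⇒m≤o _) (translate Δ) (translate-every Δ)
    length : steps (translate Δ) ≤ 4 * n
    length = m+n≤o⇒m≤o (steps (translate Δ)) (translate-steps Δ)
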